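{- Let $A$ be a closed proposition in the language of $\mathrm{HA}_{Pred}$. If $|A|$ is provable in $\mathrm{HA}_N$, then $A$ is provable in $\mathrm{HA}_{Pred}$.
   Context: All theories are in intuitionistic predicate logic. $\mathrm{HA}_{Pred}$ is the one-sorted theory over the language $0, S, Pred, +, \times, =$ whose axioms are: the axioms of equality for all these symbols; $\forall x\forall y~(S(x)=S(y)\Rightarrow x=y)$; $\forall x~\neg(0=S(x))$; the induction scheme $(0/x)P \Rightarrow \forall y~((y/x)P \Rightarrow (S(y)/x)P) \Rightarrow \forall n~(n/x)P$ for every proposition $P$ of this language; $\forall y~(0+y=y)$, $\forall x\forall y~(S(x)+y=S(x+y))$, $\forall y~(0\times y=0)$, $\forall x\forall y~(S(x)\times y=x\times y+y)$; $Pred(0)=0$, $Pred(S(x))=x$, $\forall x\forall y~(x=y\Rightarrow Pred(x)=Pred(y))$. $\mathrm{HA}_N$ is the one-sorted theory over the language $0, S, +, \times, =, Pred, Null, N$ ($Null$, $N$ unary predicates) whose axioms are: the axioms of equality for all these symbols; the relativized induction scheme $(0/x)P \Rightarrow \forall y~(N(y) \Rightarrow (y/x)P \Rightarrow (S(y)/x)P) \Rightarrow \forall n~(N(n) \Rightarrow (n/x)P)$ for every proposition $P$ of this language; $N(0)$, $\forall x~(N(x)\Rightarrow N(S(x)))$, $Pred(0)=0$, $\forall x~(Pred(S(x))=x)$, $Null(0)$, $\forall x~\neg Null(S(x))$, $\forall y~(0+y=y)$, $\forall x\forall y~(S(x)+y=S(x+y))$, $\forall y~(0\times y=0)$, $\forall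 x\forall y~(S(x)\times y=x\times y+y)$. The translation $|\cdot|$: $|P|=P$ for $P$ atomic, $|\top|=\top$, $|\bot|=\bot$, $|\cdot|$ commutes with $\wedge,\vee,\Rightarrow$, $|\forall x~A| = \forall x~(N(x)\Rightarrow |A|)$, $|\exists x~A| = \exists x~(N(x)\wedge|A|)$. -}

module Defs where

infix 0 _⨾_⊢_
infix 8 _[_]

open import Data.Nat using (ℕ; zero; suc)
open import Data.Fin using (Fin; zero; suc)
open import Data.List using (List; []; _∷_; map)
open import Data.List.Membership.Propositional using (_∈_)
open import Data.Product using (_×_)
import Data.Empty as E
import Data.Unit as U

-- Syntax: one-sorted first-order language over the symbols
-- 0, S, Pred, +, ×, =, Null, N  (de Bruijn indices; Term n / Formula n
-- have n free variables).  The language of HA_Pred is the fragment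
-- without Null and N (see InLPred below).

infixl 7 _`×_
infixl 6 _`+_
infix 4 _`=_
infixr 3 _`∧_
infixr 2 _`∨_
infixr 1 _`⇒_

data Term (n : ℕ) : Set where
  var   : Fin n → Term n
  `0    : Term n
  `S    : Term n → Term n
  `Pred : Term n → Term n
  _`+_  : Term n → Term n → Term n
  _`×_  : Term n → Term n → Term n

data Formula (n : ℕ) : Set where
  _`=_  : Term n → Term n → Formula n
  `Null : Term n → Formula n
  `N    : Term n → Formula n
  `⊤ `⊥ : Formula n
  _`∧_ _`∨_ _`⇒_ : Formula n → Formula n → Formula n
  `∀ `∃ : Formula (suc n) → Formula n

`¬ : ∀ {n} → Formula n → Formula n
`¬ A = A `⇒ `⊥

Ren : ℕ → ℕ → Set
Ren m n = Fin m → Fin n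

Sub : ℕ → ℕ → Set
Sub m n = Fin m → Term n

extR : ∀ {m n} → Ren m n → Ren (suc m) (suc n)
extR ρ zero    = zero
extR ρ (suc i) = suc (ρ i)

renT : ∀ {m n} → Ren m n → Term m → Term n
renT ρ (var i)   = var (ρ i)
renT ρ `0        = `0
renT ρ (`S t)    = `S (renT ρ t)
renT ρ (`Pred t) = `Pred (renT ρ t)
renT ρ (t `+ u)  = renT ρ t `+ renT ρ u
renT ρ (t `× u)  = renT ρ t `× renT ρ u

renF : ∀ {m n} → Ren m n → Formula m → Formula n
renF ρ (t `= u)  = renT ρ t `= renT ρ u
renF ρ (`Null t) = `Null (renT ρ t)
renF ρ (`N t)    = `N (renT ρ t)
renF ρ `⊤        = `⊤
renF ρ `⊥        = `⊥
renF ρ (A `∧ B)  = renF ρ A `∧ renF ρ B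
renF ρ (A `∨ B)  = renF ρ A `∨ renF ρ B
renF ρ (A `⇒ B)  = renF ρ A `⇒ renF ρ B
renF ρ (`∀ A)    = `∀ (renF (extR ρ) A)
renF ρ (`∃ A)    = `∃ (renF (extR ρ) A)

extS : ∀ {m n} → Sub m n → Sub (suc m) (suc n)
extS σ zero    = var zero
extS σ (suc i) = renT suc (σ i)

subT : ∀ {m n} → Sub m n → Term m → Term n
subT σ (var i)   = σ i
subT σ `0        = `0
subT σ (`S t)    = `S (subT σ t)
subT σ (`Pred t) = `Pred (subT σ t)
subT σ (t `+ u)  = subT σ t `+ subT σ u
subT σ (t `× u)  = subT σ t `× subT σ u

subF : ∀ {m n} → Sub m n → Formula m → Formula n
subF σ (t `= u)  = subT σ t `= subT σ u
subF σ (`Null t) = `Null (subT σ t)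
subF σ (`N t)    = `N (subT σ t)
subF σ `⊤        = `⊤
subF σ `⊥        = `⊥
subF σ (A `∧ B)  = subF σ A `∧ subF σ B
subF σ (A `∨ B)  = subF σ A `∨ subF σ B
subF σ (A `⇒ B)  = subF σ A `⇒ subF σ B
subF σ (`∀ A)    = `∀ (subF (extS σ) A)
subF σ (`∃ A)    = `∃ (subF (extS σ) A)

wkF : ∀ {n} → Formula n → Formula (suc n)
wkF = renF suc

_[_] : ∀ {n} → Formula (suc n) → Term n → Formula n
A [ t ] = subF σ A
  where
  σ : Sub _ _
  σ zero    = t
  σ (suc i) = var i

substSucc : ∀ {n} → Formula (suc n) → Formula (suc n)
substSucc A = subF σ A
  where
  σ : Sub _ _
  σ zero    = `S (var zero)
  σ (suc i) = var (suc i)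

-- Intuitionistic natural deduction modulo a theory.
-- A theory is a family of axioms  Ax n : Formula n → Set  (axioms may
-- have free variables); any substitution instance of an axiom may be used.

Theory : Set₁
Theory = (n : ℕ) → Formula n → Set

data _⨾_⊢_ (T : Theory) {n : ℕ} (Γ : List (Formula n)) : Formula n → Set where
  hyp  : ∀ {A} → A ∈ Γ → T ⨾ Γ ⊢ A
  ax   : ∀ {m A} → T m A → (σ : Sub m n) → T ⨾ Γ ⊢ subF σ A
  ⊤I   : T ⨾ Γ ⊢ `⊤
  ⊥E   : ∀ {A} → T ⨾ Γ ⊢ `⊥ → T ⨾ Γ ⊢ A
  ∧I   : ∀ {A B} → T ⨾ Γ ⊢ A → T ⨾ Γ ⊢ B → T ⨾ Γ ⊢ A `∧ B
  ∧E₁  : ∀ {A B} → T ⨾ Γ ⊢ A `∧ B → T ⨾ Γ ⊢ A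
  ∧E₂  : ∀ {A B} → T ⨾ Γ ⊢ A `∧ B → T ⨾ Γ ⊢ B
  ∨I₁  : ∀ {A B} → T ⨾ Γ ⊢ A → T ⨾ Γ ⊢ A `∨ B
  ∨I₂  : ∀ {A B} → T ⨾ Γ ⊢ B → T ⨾ Γ ⊢ A `∨ B
  ∨E   : ∀ {A B C} → T ⨾ Γ ⊢ A `∨ B → T ⨾ (A ∷ Γ) ⊢ C → T ⨾ (B ∷ Γ) ⊢ C
         → T ⨾ Γ ⊢ C
  ⇒I   : ∀ {A B} → T ⨾ (A ∷ Γ) ⊢ B → T ⨾ Γ ⊢ A `⇒ B
  ⇒E   : ∀ {A B} → T ⨾ Γ ⊢ A `⇒ B → T ⨾ Γ ⊢ A → T ⨾ Γ ⊢ B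
  ∀I   : ∀ {A} → T ⨾ map wkF Γ ⊢ A → T ⨾ Γ ⊢ `∀ A
  ∀E   : ∀ {A} → T ⨾ Γ ⊢ `∀ A → (t : Term n) → T ⨾ Γ ⊢ A [ t ]
  ∃I   : ∀ {A} (t : Term n) → T ⨾ Γ ⊢ A [ t ] → T ⨾ Γ ⊢ `∃ A
  ∃E   : ∀ {A B} → T ⨾ Γ ⊢ `∃ A → T ⨾ (A ∷ map wkF Γ) ⊢ wkF B → T ⨾ Γ ⊢ B

Provable : Theory → Formula 0 → Set
Provable T A = T ⨾ [] ⊢ A

InLPred : ∀ {n} → Formula n → Set
InLPred (t `= u)  = U.⊤
InLPred (`Null t) = E.⊥
InLPred (`N t)    = E.⊥
InLPred `⊤        = U.⊤
InLPred `⊥        = U.⊤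
InLPred (A `∧ B)  = InLPred A × InLPred B
InLPred (A `∨ B)  = InLPred A × InLPred B
InLPred (A `⇒ B)  = InLPred A × InLPred B
InLPred (`∀ A)    = InLPred A
InLPred (`∃ A)    = InLPred A

v0 : ∀ {n} → Term (suc n)
v0 = var zero
v1 : ∀ {n} → Term (suc (suc n))
v1 = var (suc zero)
v2 : ∀ {n} → Term (suc (suc (suc n)))
v2 = var (suc (suc zero))

data EqAxCommon : (n : ℕ) → Formula n → Set where
  eq-refl  : EqAxCommon 0 (`∀ (v0 `= v0))
  eq-S     : EqAxCommon 0 (`∀ (`∀ (v1 `= v0 `⇒ `S v1 `= `S v0)))
  eq-Pred  : EqAxCommon 0 (`∀ (`∀ (v1 `= v0 `⇒ `Pred v1 `= `Pred v0)))
  eq-+l    : EqAxCommon 0 (`∀ (`∀ (`∀ (v2 `= v1 `⇒ v2 `+ v0 `= v1 `+ v0))))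
  eq-+r    : EqAxCommon 0 (`∀ (`∀ (`∀ (v2 `= v1 `⇒ v0 `+ v2 `= v0 `+ v1))))
  eq-×l    : EqAxCommon 0 (`∀ (`∀ (`∀ (v2 `= v1 `⇒ v2 `× v0 `= v1 `× v0))))
  eq-×r    : EqAxCommon 0 (`∀ (`∀ (`∀ (v2 `= v1 `⇒ v0 `× v2 `= v0 `× v1))))
  eq-=l    : EqAxCommon 0 (`∀ (`∀ (`∀ (v2 `= v1 `⇒ v2 `= v0 `⇒ v1 `= v0))))
  eq-=r    : EqAxCommon 0 (`∀ (`∀ (`∀ (v2 `= v1 `⇒ v0 `= v2 `⇒ v0 `= v1))))

data HAPred : Theory where
  eqax      : ∀ {n A} → EqAxCommon n A → HAPred n A
  S-inj     : HAPred 0 (`∀ (`∀ (`S v1 `= `S v0 `⇒ v1 `= v0)))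
  zero≢S    : HAPred 0 (`∀ (`¬ (`0 `= `S v0)))
  induction : ∀ {n} (P : Formula (suc n)) → InLPred P →
              HAPred n (P [ `0 ] `⇒ `∀ (P `⇒ substSucc P) `⇒ `∀ P)
  plus-0    : HAPred 0 (`∀ (`0 `+ v0 `= v0))
  plus-S    : HAPred 0 (`∀ (`∀ (`S v1 `+ v0 `= `S (v1 `+ v0))))
  times-0   : HAPred 0 (`∀ (`0 `× v0 `= `0))
  times-S   : HAPred 0 (`∀ (`∀ (`S v1 `× v0 `= v1 `× v0 `+ v0)))
  pred-0    : HAPred 0 (`Pred `0 `= `0)
  pred-S    : HAPred 1 (`Pred (`S v0) `= v0)
  pred-cong : HAPred 0 (`∀ (`∀ (v1 `= v0 `⇒ `Pred v1 `= `Pred v0)))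

data HAN : Theory where
  eqax      : ∀ {n A} → EqAxCommon n A → HAN n A
  eq-Null   : HAN 0 (`∀ (`∀ (v1 `= v0 `⇒ `Null v1 `⇒ `Null v0)))
  eq-N      : HAN 0 (`∀ (`∀ (v1 `= v0 `⇒ `N v1 `⇒ `N v0)))
  induction : ∀ {n} (P : Formula (suc n)) →
              HAN n (P [ `0 ] `⇒ `∀ (`N v0 `⇒ P `⇒ substSucc P)
                       `⇒ `∀ (`N v0 `⇒ P))
  N-0       : HAN 0 (`N `0)
  N-S       : HAN 0 (`∀ (`N v0 `⇒ `N (`S v0)))
  pred-0    : HAN 0 (`Pred `0 `= `0)
  pred-S    : HAN 0 (`∀ (`Pred (`S v0) `= v0))
  null-0    : HAN 0 (`Null `0)
  null-S    : HAN 0 (`∀ (`¬ (`Null (`S v0))))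
  plus-0    : HAN 0 (`∀ (`0 `+ v0 `= v0))
  plus-S    : HAN 0 (`∀ (`∀ (`S v1 `+ v0 `= `S (v1 `+ v0))))
  times-0   : HAN 0 (`∀ (`0 `× v0 `= `0))
  times-S   : HAN 0 (`∀ (`∀ (`S v1 `× v0 `= v1 `× v0 `+ v0)))

∣_∣ : ∀ {n} → Formula n → Formula n
∣ t `= u ∣  = t `= u
∣ `Null t ∣ = `Null t
∣ `N t ∣    = `N t
∣ `⊤ ∣      = `⊤
∣ `⊥ ∣      = `⊥
∣ A `∧ B ∣  = ∣ A ∣ `∧ ∣ B ∣
∣ A `∨ B ∣  = ∣ A ∣ `∨ ∣ B ∣
∣ A `⇒ B ∣  = ∣ A ∣ `⇒ ∣ B ∣
∣ `∀ A ∣    = `∀ (`N v0 `⇒ ∣ A ∣)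
∣ `∃ A ∣    = `∃ (`N v0 `∧ ∣ A ∣)

-- Interpret HA_N in HA_Pred by reading N t as ⊤ and Null t as t = 0. Every axiom
-- of HA_N becomes a theorem of HA_Pred (relativised induction turns into plain
-- induction once the guards ⊤ are dropped), so every proof in HA_N maps to a proof
-- in HA_Pred. For A in the language of HA_Pred the image of ∣ A ∣ differs from A
-- only by guards ⊤ ⇒ _ and ⊤ ∧ _ on quantifiers, hence is equivalent to A.
module Submission where

open import Defs
open import Data.Nat using (ℕ; suc)
open import Data.Fin using (zero; suc)
open import Data.List using (List; []; _∷_; map)
open import Data.List.Membership.Propositional.Properties using (∈-map⁺)
open import Data.List.Relation.Binary.Subset.Propositional using (_⊆_)
open import Data.List.Relation.Binary.Subset.Propositional.Properties using (map⁺; ∷⁺ʳ)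
open import Data.List.Relation.Unary.Any using (here; there)
open import Data.Product using (_×_; _,_; proj₁; swap)
open import Relation.Binary.PropositionalEquality using (_≡_; refl; sym; cong; cong₂; subst)
import Data.Unit as U

private
  variable
    m n : ℕ
    T : Theory

weaken : ∀ {Γ Δ : List (Formula n)} {A} → Γ ⊆ Δ → T ⨾ Γ ⊢ A → T ⨾ Δ ⊢ A
weaken Γ⊆Δ (hyp A∈Γ) = hyp (Γ⊆Δ A∈Γ)
weaken Γ⊆Δ (ax a σ)  = ax a σ
weaken Γ⊆Δ ⊤I        = ⊤I
weaken Γ⊆Δ (⊥E d)    = ⊥E (weaken Γ⊆Δ d)
weaken Γ⊆Δ (∧I d e)  = ∧I (weaken Γ⊆Δ d) (weaken Γ⊆Δ e)
weaken Γ⊆Δ (∧E₁ d)   = ∧E₁ (weaken Γ⊆Δ d)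
weaken Γ⊆Δ (∧E₂ d)   = ∧E₂ (weaken Γ⊆Δ d)
weaken Γ⊆Δ (∨I₁ d)   = ∨I₁ (weaken Γ⊆Δ d)
weaken Γ⊆Δ (∨I₂ d)   = ∨I₂ (weaken Γ⊆Δ d)
weaken Γ⊆Δ (∨E d e f) =
  ∨E (weaken Γ⊆Δ d) (weaken (∷⁺ʳ _ Γ⊆Δ) e) (weaken (∷⁺ʳ _ Γ⊆Δ) f)
weaken Γ⊆Δ (⇒I d)    = ⇒I (weaken (∷⁺ʳ _ Γ⊆Δ) d)
weaken Γ⊆Δ (⇒E d e)  = ⇒E (weaken Γ⊆Δ d) (weaken Γ⊆Δ e)
weaken Γ⊆Δ (∀I d)    = ∀I (weaken (map⁺ wkF Γ⊆Δ) d)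
weaken Γ⊆Δ (∀E d t)  = ∀E (weaken Γ⊆Δ d) t
weaken Γ⊆Δ (∃I t d)  = ∃I t (weaken Γ⊆Δ d)
weaken Γ⊆Δ (∃E d e)  = ∃E (weaken Γ⊆Δ d) (weaken (∷⁺ʳ _ (map⁺ wkF Γ⊆Δ)) e)

⇒E₀ : ∀ {Γ : List (Formula n)} {A B} → T ⨾ [] ⊢ A `⇒ B → T ⨾ Γ ⊢ A → T ⨾ Γ ⊢ B
⇒E₀ f = ⇒E (weaken (λ ()) f)

cast : ∀ {Γ : List (Formula n)} {A B} → A ≡ B → T ⨾ Γ ⊢ A → T ⨾ Γ ⊢ B
cast = subst (_ ⨾ _ ⊢_)

subT-renT-cancel : (ρ : Ren m n) (σ : Sub n m) → (∀ i → σ (ρ i) ≡ var i) →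
                   ∀ t → subT σ (renT ρ t) ≡ t
subT-renT-cancel ρ σ inv (var i)   = inv i
subT-renT-cancel ρ σ inv `0        = refl
subT-renT-cancel ρ σ inv (`S t)    = cong `S (subT-renT-cancel ρ σ inv t)
subT-renT-cancel ρ σ inv (`Pred t) = cong `Pred (subT-renT-cancel ρ σ inv t)
subT-renT-cancel ρ σ inv (t `+ u)  =
  cong₂ _`+_ (subT-renT-cancel ρ σ inv t) (subT-renT-cancel ρ σ inv u)
subT-renT-cancel ρ σ inv (t `× u)  =
  cong₂ _`×_ (subT-renT-cancel ρ σ inv t) (subT-renT-cancel ρ σ inv u)

ext-cancel : ∀ {ρ : Ren m n} {σ : Sub n m} → (∀ i → σ (ρ i) ≡ var i) →
             ∀ i → extS σ (extR ρ i) ≡ var i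
ext-cancel inv zero    = refl
ext-cancel inv (suc i) = cong (renT suc) (inv i)

subF-renF-cancel : (ρ : Ren m n) (σ : Sub n m) → (∀ i → σ (ρ i) ≡ var i) →
                   ∀ A → subF σ (renF ρ A) ≡ A
subF-renF-cancel ρ σ inv (t `= u)  =
  cong₂ _`=_ (subT-renT-cancel ρ σ inv t) (subT-renT-cancel ρ σ inv u)
subF-renF-cancel ρ σ inv (`Null t) = cong `Null (subT-renT-cancel ρ σ inv t)
subF-renF-cancel ρ σ inv (`N t)    = cong `N (subT-renT-cancel ρ σ inv t)
subF-renF-cancel ρ σ inv `⊤        = refl
subF-renF-cancel ρ σ inv `⊥        = refl
subF-renF-cancel ρ σ inv (A `∧ B)  =
  cong₂ _`∧_ (subF-renF-cancel ρ σ inv A) (subF-renF-cancel ρ σ inv B)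
subF-renF-cancel ρ σ inv (A `∨ B)  =
  cong₂ _`∨_ (subF-renF-cancel ρ σ inv A) (subF-renF-cancel ρ σ inv B)
subF-renF-cancel ρ σ inv (A `⇒ B)  =
  cong₂ _`⇒_ (subF-renF-cancel ρ σ inv A) (subF-renF-cancel ρ σ inv B)
subF-renF-cancel ρ σ inv (`∀ A)    = cong `∀ (subF-renF-cancel _ _ (ext-cancel inv) A)
subF-renF-cancel ρ σ inv (`∃ A)    = cong `∃ (subF-renF-cancel _ _ (ext-cancel inv) A)

wkF-under-binder-[v0] : (A : Formula (suc n)) → renF (extR suc) A [ v0 ] ≡ A
wkF-under-binder-[v0] A =
  subF-renF-cancel (extR suc) _ (λ { zero → refl ; (suc i) → refl }) A

∀E-fresh : ∀ {Γ : List (Formula (suc n))} {A} → T ⨾ Γ ⊢ wkF (`∀ A) → T ⨾ Γ ⊢ A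
∀E-fresh {A = A} d = cast (wkF-under-binder-[v0] A) (∀E d v0)

∃I-fresh : ∀ {Γ : List (Formula (suc n))} {A} → T ⨾ Γ ⊢ A → T ⨾ Γ ⊢ wkF (`∃ A)
∃I-fresh {A = A} d = ∃I v0 (cast (sym (wkF-under-binder-[v0] A)) d)

_⊣⊢[_]_ : Formula n → Theory → Formula n → Set
A ⊣⊢[ T ] B = (T ⨾ [] ⊢ A `⇒ B) × (T ⨾ [] ⊢ B `⇒ A)

⊣⊢-refl : (A : Formula n) → A ⊣⊢[ T ] A
⊣⊢-refl A = ⇒I (hyp (here refl)) , ⇒I (hyp (here refl))

⊣⊢-sym : ∀ {A B : Formula n} → A ⊣⊢[ T ] B → B ⊣⊢[ T ] A
⊣⊢-sym = swap

⊣⊢-trans : ∀ {A B C : Formula n} → A ⊣⊢[ T ] B → B ⊣⊢[ T ] C → A ⊣⊢[ T ] C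
⊣⊢-trans (f , f′) (g , g′) =
  ⇒I (⇒E₀ g (⇒E₀ f (hyp (here refl)))) , ⇒I (⇒E₀ f′ (⇒E₀ g′ (hyp (here refl))))

∧-cong : ∀ {A A′ B B′ : Formula n} → A ⊣⊢[ T ] A′ → B ⊣⊢[ T ] B′ →
         (A `∧ B) ⊣⊢[ T ] (A′ `∧ B′)
∧-cong (f , f′) (g , g′) = map∧ f g , map∧ f′ g′
  where
  map∧ : ∀ {A A′ B B′} → T ⨾ [] ⊢ A `⇒ A′ → T ⨾ [] ⊢ B `⇒ B′ →
         T ⨾ [] ⊢ A `∧ B `⇒ A′ `∧ B′
  map∧ f g = ⇒I (∧I (⇒E₀ f (∧E₁ (hyp (here refl)))) (⇒E₀ g (∧E₂ (hyp (here refl)))))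

∨-cong : ∀ {A A′ B B′ : Formula n} → A ⊣⊢[ T ] A′ → B ⊣⊢[ T ] B′ →
         (A `∨ B) ⊣⊢[ T ] (A′ `∨ B′)
∨-cong (f , f′) (g , g′) = map∨ f g , map∨ f′ g′
  where
  map∨ : ∀ {A A′ B B′} → T ⨾ [] ⊢ A `⇒ A′ → T ⨾ [] ⊢ B `⇒ B′ →
         T ⨾ [] ⊢ A `∨ B `⇒ A′ `∨ B′
  map∨ f g = ⇒I (∨E (hyp (here refl)) (∨I₁ (⇒E₀ f (hyp (here refl))))
                                      (∨I₂ (⇒E₀ g (hyp (here refl)))))

⇒-cong : ∀ {A A′ B B′ : Formula n} → A ⊣⊢[ T ] A′ → B ⊣⊢[ T ] B′ →
         (A `⇒ B) ⊣⊢[ T ] (A′ `⇒ B′)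
⇒-cong (f , f′) (g , g′) = map⇒ f′ g , map⇒ f g′
  where
  map⇒ : ∀ {A A′ B B′} → T ⨾ [] ⊢ A′ `⇒ A → T ⨾ [] ⊢ B `⇒ B′ →
         T ⨾ [] ⊢ (A `⇒ B) `⇒ (A′ `⇒ B′)
  map⇒ f g = ⇒I (⇒I (⇒E₀ g (⇒E (hyp (there (here refl))) (⇒E₀ f (hyp (here refl))))))

∀-cong : ∀ {A B : Formula (suc n)} → A ⊣⊢[ T ] B → `∀ A ⊣⊢[ T ] `∀ B
∀-cong (f , f′) = map∀ f , map∀ f′
  where
  map∀ : ∀ {A B} → T ⨾ [] ⊢ A `⇒ B → T ⨾ [] ⊢ `∀ A `⇒ `∀ B
  map∀ f = ⇒I (∀I (⇒E₀ f (∀E-fresh (hyp (here refl)))))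

∃-cong : ∀ {A B : Formula (suc n)} → A ⊣⊢[ T ] B → `∃ A ⊣⊢[ T ] `∃ B
∃-cong (f , f′) = map∃ f , map∃ f′
  where
  map∃ : ∀ {A B} → T ⨾ [] ⊢ A `⇒ B → T ⨾ [] ⊢ `∃ A `⇒ `∃ B
  map∃ f = ⇒I (∃E (hyp (here refl)) (∃I-fresh (⇒E₀ f (hyp (here refl)))))

⊤⇒-identityˡ : (A : Formula n) → (`⊤ `⇒ A) ⊣⊢[ T ] A
⊤⇒-identityˡ A = ⇒I (⇒E (hyp (here refl)) ⊤I) , ⇒I (⇒I (hyp (there (here refl))))

⊤∧-identityˡ : (A : Formula n) → (`⊤ `∧ A) ⊣⊢[ T ] A
⊤∧-identityˡ A = ⇒I (∧E₂ (hyp (here refl))) , ⇒I (∧I ⊤I (hyp (here refl)))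

toLPred : Formula n → Formula n
toLPred (t `= u)  = t `= u
toLPred (`Null t) = t `= `0
toLPred (`N t)    = `⊤
toLPred `⊤        = `⊤
toLPred `⊥        = `⊥
toLPred (A `∧ B)  = toLPred A `∧ toLPred B
toLPred (A `∨ B)  = toLPred A `∨ toLPred B
toLPred (A `⇒ B)  = toLPred A `⇒ toLPred B
toLPred (`∀ A)    = `∀ (toLPred A)
toLPred (`∃ A)    = `∃ (toLPred A)

toLPred-InLPred : (A : Formula n) → InLPred (toLPred A)
toLPred-InLPred (t `= u)  = U.tt
toLPred-InLPred (`Null t) = U.tt
toLPred-InLPred (`N t)    = U.tt
toLPred-InLPred `⊤        = U.tt
toLPred-InLPred `⊥        = U.tt
toLPred-InLPred (A `∧ B)  = toLPred-InLPred A , toLPred-InLPred B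
toLPred-InLPred (A `∨ B)  = toLPred-InLPred A , toLPred-InLPred B
toLPred-InLPred (A `⇒ B)  = toLPred-InLPred A , toLPred-InLPred B
toLPred-InLPred (`∀ A)    = toLPred-InLPred A
toLPred-InLPred (`∃ A)    = toLPred-InLPred A

toLPred-subF : (σ : Sub m n) (A : Formula m) → toLPred (subF σ A) ≡ subF σ (toLPred A)
toLPred-subF σ (t `= u)  = refl
toLPred-subF σ (`Null t) = refl
toLPred-subF σ (`N t)    = refl
toLPred-subF σ `⊤        = refl
toLPred-subF σ `⊥        = refl
toLPred-subF σ (A `∧ B)  = cong₂ _`∧_ (toLPred-subF σ A) (toLPred-subF σ B)
toLPred-subF σ (A `∨ B)  = cong₂ _`∨_ (toLPred-subF σ A) (toLPred-subF σ B)
toLPred-subF σ (A `⇒ B)  = cong₂ _`⇒_ (toLPred-subF σ A) (toLPred-subF σ B)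
toLPred-subF σ (`∀ A)    = cong `∀ (toLPred-subF (extS σ) A)
toLPred-subF σ (`∃ A)    = cong `∃ (toLPred-subF (extS σ) A)

toLPred-renF : (ρ : Ren m n) (A : Formula m) → toLPred (renF ρ A) ≡ renF ρ (toLPred A)
toLPred-renF ρ (t `= u)  = refl
toLPred-renF ρ (`Null t) = refl
toLPred-renF ρ (`N t)    = refl
toLPred-renF ρ `⊤        = refl
toLPred-renF ρ `⊥        = refl
toLPred-renF ρ (A `∧ B)  = cong₂ _`∧_ (toLPred-renF ρ A) (toLPred-renF ρ B)
toLPred-renF ρ (A `∨ B)  = cong₂ _`∨_ (toLPred-renF ρ A) (toLPred-renF ρ B)
toLPred-renF ρ (A `⇒ B)  = cong₂ _`⇒_ (toLPred-renF ρ A) (toLPred-renF ρ B)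
toLPred-renF ρ (`∀ A)    = cong `∀ (toLPred-renF (extR ρ) A)
toLPred-renF ρ (`∃ A)    = cong `∃ (toLPred-renF (extR ρ) A)

toLPred-map-wkF : (Γ : List (Formula n)) → map toLPred (map wkF Γ) ≡ map wkF (map toLPred Γ)
toLPred-map-wkF []      = refl
toLPred-map-wkF (A ∷ Γ) = cong₂ _∷_ (toLPred-renF suc A) (toLPred-map-wkF Γ)

=-refl : ∀ {Γ : List (Formula n)} (t : Term n) → HAPred ⨾ Γ ⊢ t `= t
=-refl t = ∀E (ax (eqax eq-refl) (λ ())) t

=-zero-congruence : ∀ {Γ : List (Formula n)} →
                    HAPred ⨾ Γ ⊢ `∀ (`∀ (v1 `= v0 `⇒ v1 `= `0 `⇒ v0 `= `0))
=-zero-congruence =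
  ∀I (∀I (⇒I (⇒I (⇒E (⇒E (∀E (∀E (∀E (ax (eqax eq-=l) (λ ())) v1) v0) `0)
                         (hyp (there (here refl))))
                     (hyp (here refl))))))

S≢0 : ∀ {Γ : List (Formula n)} → HAPred ⨾ Γ ⊢ `∀ (`¬ (`S v0 `= `0))
S≢0 = ∀I (⇒I (⇒E (∀E (ax zero≢S (λ ())) v0)
                 (⇒E (⇒E (∀E (∀E (∀E (ax (eqax eq-=l) (λ ())) (`S v0)) `0) (`S v0))
                         (hyp (here refl)))
                     (=-refl (`S v0)))))

relativised-induction : ∀ (B : Formula n) Q Q′ →
  (B `⇒ `∀ (Q `⇒ Q′) `⇒ `∀ Q) ⊣⊢[ HAPred ] (B `⇒ `∀ (`⊤ `⇒ Q `⇒ Q′) `⇒ `∀ (`⊤ `⇒ Q))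
relativised-induction B Q Q′ =
  ⇒-cong (⊣⊢-refl B) (⇒-cong (∀-cong (⊣⊢-sym (⊤⇒-identityˡ _)))
                              (∀-cong (⊣⊢-sym (⊤⇒-identityˡ Q))))

toLPred-axiom : ∀ {A : Formula m} {Δ : List (Formula n)} → HAN m A → (σ : Sub m n) →
                HAPred ⨾ Δ ⊢ subF σ (toLPred A)
toLPred-axiom (eqax eq-refl) σ = ax (eqax eq-refl) σ
toLPred-axiom (eqax eq-S)    σ = ax (eqax eq-S) σ
toLPred-axiom (eqax eq-Pred) σ = ax (eqax eq-Pred) σ
toLPred-axiom (eqax eq-+l)   σ = ax (eqax eq-+l) σ
toLPred-axiom (eqax eq-+r)   σ = ax (eqax eq-+r) σ
toLPred-axiom (eqax eq-×l)   σ = ax (eqax eq-×l) σ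
toLPred-axiom (eqax eq-×r)   σ = ax (eqax eq-×r) σ
toLPred-axiom (eqax eq-=l)   σ = ax (eqax eq-=l) σ
toLPred-axiom (eqax eq-=r)   σ = ax (eqax eq-=r) σ
toLPred-axiom eq-Null        σ = =-zero-congruence
toLPred-axiom eq-N           σ = ∀I (∀I (⇒I (⇒I ⊤I)))
toLPred-axiom (induction P)  σ =
  ⇒E₀ (proj₁ (relativised-induction _ _ _))
      (cast (cong₂ (λ base step → base `⇒ `∀ (Q `⇒ step) `⇒ `∀ Q)
                   (cong (subF σ) (sym (toLPred-subF _ P)))
                   (cong (subF (extS σ)) (sym (toLPred-subF _ P))))
            (ax (induction (toLPred P) (toLPred-InLPred P)) σ))
  where Q = subF (extS σ) (toLPred P)
toLPred-axiom N-0            σ = ⊤I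
toLPred-axiom N-S            σ = ∀I (⇒I ⊤I)
toLPred-axiom pred-0         σ = ax pred-0 σ
toLPred-axiom pred-S         σ = ∀I (ax pred-S (λ _ → v0))
toLPred-axiom null-0         σ = =-refl `0
toLPred-axiom null-S         σ = S≢0
toLPred-axiom plus-0         σ = ax plus-0 σ
toLPred-axiom plus-S         σ = ax plus-S σ
toLPred-axiom times-0        σ = ax times-0 σ
toLPred-axiom times-S        σ = ax times-S σ

toLPred-derivation : ∀ {Γ : List (Formula n)} {A} →
                     HAN ⨾ Γ ⊢ A → HAPred ⨾ map toLPred Γ ⊢ toLPred A
toLPred-derivation (hyp A∈Γ)  = hyp (∈-map⁺ toLPred A∈Γ)
toLPred-derivation (ax {A = A} a σ) = cast (sym (toLPred-subF σ A)) (toLPred-axiom a σ)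
toLPred-derivation ⊤I         = ⊤I
toLPred-derivation (⊥E d)     = ⊥E (toLPred-derivation d)
toLPred-derivation (∧I d e)   = ∧I (toLPred-derivation d) (toLPred-derivation e)
toLPred-derivation (∧E₁ d)    = ∧E₁ (toLPred-derivation d)
toLPred-derivation (∧E₂ d)    = ∧E₂ (toLPred-derivation d)
toLPred-derivation (∨I₁ d)    = ∨I₁ (toLPred-derivation d)
toLPred-derivation (∨I₂ d)    = ∨I₂ (toLPred-derivation d)
toLPred-derivation (∨E d e f) =
  ∨E (toLPred-derivation d) (toLPred-derivation e) (toLPred-derivation f)
toLPred-derivation (⇒I d)     = ⇒I (toLPred-derivation d)
toLPred-derivation (⇒E d e)   = ⇒E (toLPred-derivation d) (toLPred-derivation e)
toLPred-derivation {Γ = Γ} (∀I d) =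
  ∀I (subst (_ ⨾_⊢ _) (toLPred-map-wkF Γ) (toLPred-derivation d))
toLPred-derivation (∀E {A = A} d t) =
  cast (sym (toLPred-subF _ A)) (∀E (toLPred-derivation d) t)
toLPred-derivation (∃I {A = A} t d) =
  ∃I t (cast (toLPred-subF _ A) (toLPred-derivation d))
toLPred-derivation {Γ = Γ} (∃E {A = A} {B = B} d e) =
  ∃E (toLPred-derivation d)
     (subst (λ Δ → _ ⨾ toLPred A ∷ Δ ⊢ _) (toLPred-map-wkF Γ)
            (cast (toLPred-renF suc B) (toLPred-derivation e)))

toLPred-∣∣-⊣⊢ : (A : Formula n) → InLPred A → toLPred ∣ A ∣ ⊣⊢[ HAPred ] A
toLPred-∣∣-⊣⊢ (t `= u) _        = ⊣⊢-refl (t `= u)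
toLPred-∣∣-⊣⊢ `⊤ _              = ⊣⊢-refl `⊤
toLPred-∣∣-⊣⊢ `⊥ _              = ⊣⊢-refl `⊥
toLPred-∣∣-⊣⊢ (A `∧ B) (lA , lB) = ∧-cong (toLPred-∣∣-⊣⊢ A lA) (toLPred-∣∣-⊣⊢ B lB)
toLPred-∣∣-⊣⊢ (A `∨ B) (lA , lB) = ∨-cong (toLPred-∣∣-⊣⊢ A lA) (toLPred-∣∣-⊣⊢ B lB)
toLPred-∣∣-⊣⊢ (A `⇒ B) (lA , lB) = ⇒-cong (toLPred-∣∣-⊣⊢ A lA) (toLPred-∣∣-⊣⊢ B lB)
toLPred-∣∣-⊣⊢ (`∀ A) lA =
  ∀-cong (⊣⊢-trans (⊤⇒-identityˡ (toLPred ∣ A ∣)) (toLPred-∣∣-⊣⊢ A lA))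
toLPred-∣∣-⊣⊢ (`∃ A) lA =
  ∃-cong (⊣⊢-trans (⊤∧-identityˡ (toLPred ∣ A ∣)) (toLPred-∣∣-⊣⊢ A lA))

proposition10 : (A : Formula 0) → InLPred A →
                Provable HAN ∣ A ∣ → Provable HAPred A
proposition10 A A∈LPred ⊢∣A∣ =
  ⇒E₀ (proj₁ (toLPred-∣∣-⊣⊢ A A∈LPred)) (toLPred-derivation ⊢∣A∣)
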